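{- Every true combinatorial proposition has a combinatorial proof.
   Context: A graph $(V,E)$: finite $V$, $E$ a set of two-element subsets of $V$; write $vw$. A homomorphism $h:G\to G'$ satisfies $vw\in E(G)\Rightarrow h(v)h(w)\in E(G')$; it is a skew fibration if for every $v\in V(G)$ and every $w$ with $h(v)w\in E(G')$ there is $\hat w$ with $v\hat w\in E(G)$ and $h(\hat w)w\notin E(G')$. A cograph is a graph with nonempty vertex set such that for distinct $v,w,x,y$ the edges among $\{v,w,x,y\}$ are not exactly $\{vw,wx,xy\}$. Atoms: literals $p,\overline p$ (variables $p$) and constants $0,1$; $p,\overline p$ dual. A combinatorial proposition is a cograph with an atom label on each vertex. A stable set contains no edge; a clause is a maximal stable set; a clause is true if it contains a $1$-labelled vertex or two vertices labelled by dual literals; a labelled graph is true if all its clauses are true. A coloured graph has an equivalence relation $\sim$ on $V$ with $v\sim w$, $v\ne w$ implying $vw\notin E$; classes are colour classes. $W$ induces a matching if $W\ne\emptyset$ and each $w\in W$ has a unique $w'\in W$ with $ww'\in E$. Nicely coloured: every colour class has at most two vertices and no union of two-vertex colour classes induces a matching. A combinatorial proof of a combinatorial proposition $P$ is a skew fibration $h:C\to P$ from a nicely coloured cograph $C$ whose colour classes are axiomatic: a class $\{v\}$ with $h(v)$ labelled $1$, or a class $\{v,w\}$ with $h(v),h(w)$ labelled by dual literals. -}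

module Defs where

open import Data.Nat using (ℕ; suc)
open import Data.Fin using (Fin)
open import Data.Bool using (Bool; true; false; T)
open import Data.Product using (Σ; ∃; ∃-syntax; _×_; _,_)
open import Data.Sum using (_⊎_)
open import Relation.Binary.PropositionalEquality using (_≡_; _≢_)
open import Relation.Binary.Structures using (IsEquivalence)
open import Relation.Nullary using (¬_)
open import Data.Fin.Subset using (Subset; _∈_; _∉_; _⊆_)

-- Graphs: finite vertex set Fin n; E a symmetric irreflexive adjacency
-- relation (equivalently, a set of two-element subsets of Fin n).

record Graph : Set where
  field
    size   : ℕ
    adj    : Fin size → Fin size → Bool
    adj-sym     : ∀ v w → adj v w ≡ adj w v
    adj-irrefl  : ∀ v → adj v v ≡ false
open Graph public

V : Graph → Set
V G = Fin (size G)

Edge : (G : Graph) → V G → V G → Set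
Edge G v w = T (adj G v w)

IsHom : (G G' : Graph) → (V G → V G') → Set
IsHom G G' h = ∀ v w → Edge G v w → Edge G' (h v) (h w)

IsSkewFibration : (G G' : Graph) → (V G → V G') → Set
IsSkewFibration G G' h =
  IsHom G G' h ×
  (∀ (v : V G) (w : V G') → Edge G' (h v) w →
     ∃[ ŵ ] (Edge G v ŵ × ¬ Edge G' (h ŵ) w))

IsCograph : Graph → Set
IsCograph G =
  V G ×   -- nonempty vertex set (an inhabitant)
  (∀ (v w x y : V G) →
     v ≢ w → v ≢ x → v ≢ y → w ≢ x → w ≢ y → x ≢ y →
     ¬ ( Edge G v w × Edge G w x × Edge G x y ×
         ¬ Edge G v x × ¬ Edge G v y × ¬ Edge G w y))

data Atom : Set where
  pos  : ℕ → Atom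
  neg  : ℕ → Atom
  𝟘    : Atom
  𝟙    : Atom

data Dual : Atom → Atom → Set where
  pos-neg : ∀ p → Dual (pos p) (neg p)
  neg-pos : ∀ p → Dual (neg p) (pos p)

record CombProp : Set where
  field
    graph   : Graph
    cograph : IsCograph graph
    label   : V graph → Atom
open CombProp public

IsStable : (G : Graph) → Subset (size G) → Set
IsStable G S = ∀ v w → v ∈ S → w ∈ S → ¬ Edge G v w

IsClause : (G : Graph) → Subset (size G) → Set
IsClause G S = IsStable G S × (∀ T → IsStable G T → S ⊆ T → T ⊆ S)

IsTrueClause : (G : Graph) → (V G → Atom) → Subset (size G) → Set
IsTrueClause G ℓ S =
  (∃[ v ] (v ∈ S × ℓ v ≡ 𝟙)) ⊎
  (∃[ v ] ∃[ w ] (v ∈ S × w ∈ S × Dual (ℓ v) (ℓ w)))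

IsTrue : CombProp → Set
IsTrue P = ∀ S → IsClause (graph P) S → IsTrueClause (graph P) (label P) S

record ColouredGraph : Set₁ where
  field
    cgraph   : Graph
    _~_      : V cgraph → V cgraph → Set
    ~-equiv  : IsEquivalence _~_
    ~-stable : ∀ v w → v ~ w → v ≢ w → ¬ Edge cgraph v w
open ColouredGraph public

InducesMatching : (G : Graph) → Subset (size G) → Set
InducesMatching G W =
  (∃[ w ] (w ∈ W)) ×
  (∀ w → w ∈ W →
     ∃[ w' ] (w' ∈ W × Edge G w w' ×
              (∀ w'' → w'' ∈ W → Edge G w w'' → w'' ≡ w')))

IsUnionOfPairClasses : (C : ColouredGraph) → Subset (size (cgraph C)) → Set
IsUnionOfPairClasses C W =
  (∀ v w → v ∈ W → _~_ C v w → w ∈ W) ×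
  (∀ v → v ∈ W → ∃[ w ] (w ≢ v × _~_ C v w))

IsNicelyColoured : ColouredGraph → Set
IsNicelyColoured C =
  (∀ a b c → _~_ C a b → _~_ C a c → a ≡ b ⊎ a ≡ c ⊎ b ≡ c) ×
  (∀ W → IsUnionOfPairClasses C W → ¬ InducesMatching (cgraph C) W)

AxiomaticClasses : (C : ColouredGraph) → (V (cgraph C) → Atom) → Set
AxiomaticClasses C ℓ = ∀ v →
  ((∀ w → _~_ C v w → w ≡ v) × ℓ v ≡ 𝟙) ⊎
  (∃[ w ] (w ≢ v × _~_ C v w × Dual (ℓ v) (ℓ w)))

record CombProof (P : CombProp) : Set₁ where
  field
    C          : ColouredGraph
    C-cograph  : IsCograph (cgraph C)
    C-nice     : IsNicelyColoured C
    h          : V (cgraph C) → V (graph P)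
    h-skew     : IsSkewFibration (cgraph C) (graph P) h
    axiomatic  : AxiomaticClasses C (λ v → label P (h v))

-- Build, by well-founded induction on vertex sets U of P all of whose maximal stable subsets
-- are clauses of P, a fragment over U: a nicely coloured cograph with an axiomatic homomorphism
-- into U that is a skew fibration towards the vertices of U.  A stable U is itself a clause,
-- hence true, so one 1-labelled vertex or two dual ones form a fragment.  Otherwise, since P is
-- a cograph, an edge of U lies in a union of components of U that is a join of K₁ and K₂; the
-- hypothesis passes to U ∖ K₂ and U ∖ K₁, and their fragments are glued by joining the vertices
-- over K₁ to those over K₂.  Niceness survives the gluing because the induction maintains the
-- stronger property that no union of two-vertex colour classes induces a matching even with one
-- extra isolated vertex.  A fragment over all of V(P) is a combinatorial proof of P.

module Submission where

open import Defs
open import Data.Nat using (ℕ; _<_; _+_)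
open import Data.Nat.Induction using (<-wellFounded)
open import Induction.WellFounded using (Acc; acc)
open import Data.Fin using (Fin; zero; suc) renaming (_≟_ to _≟ᶠ_)
open import Data.Fin.Properties using (any?; +↔⊎)
open import Data.Fin.Subset using (Subset; _∈_; ∣_∣)
open import Data.Fin.Subset.Properties using (p⊂q⇒∣p∣<∣q∣)
open import Data.Vec using (tabulate; lookup)
open import Data.Vec.Properties using (lookup∘tabulate; []=⇒lookup; lookup⇒[]=)
open import Data.Bool using (Bool; true; false; T; not; _∧_)
open import Data.Bool.Properties using (¬-not; not-¬; not-involutive; not-injective; ∧-zeroʳ) renaming (_≟_ to _≟ᵇ_)
open import Data.Product using (Σ; ∃; ∃₂; _×_; _,_; proj₁; proj₂)
open import Data.Sum using (_⊎_; inj₁; inj₂) renaming (map to ⊎-map; swap to ⊎-swap)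
open import Data.Unit using (tt)
open import Function using (_∘_; _↔_; Inverse)
open import Function.Properties.Inverse using (↔-refl; ↔-sym; ↔-trans)
open import Data.Sum.Function.Propositional using (_⊎-↔_)
open import Data.Sum.Properties using (inj₁-injective; inj₂-injective)
open import Data.Empty using (⊥; ⊥-elim)
open import Relation.Nullary using (¬_; Dec; yes; no; does)
open import Relation.Nullary.Decidable using (_×-dec_; ¬?; dec-true; dec-false; map′)
open import Relation.Unary using (Decidable)
open import Relation.Binary.PropositionalEquality

contradictionᵇ : ∀ {b} → b ≡ true → b ≡ false → ⊥
contradictionᵇ b≡true b≡false with () ← trans (sym b≡true) b≡false

≢not⇒≡ : ∀ {b c : Bool} → b ≢ not c → b ≡ c
≢not⇒≡ {b} {c} b≢not-c = trans (¬-not b≢not-c) (not-involutive c)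

T⁺ : ∀ {b} → b ≡ true → T b
T⁺ refl = tt

T⁻ : ∀ {b} → T b → b ≡ true
T⁻ {true} _ = refl

¬T⁺ : ∀ {b} → b ≡ false → ¬ T b
¬T⁺ refl ()

¬T⁻ : ∀ {b} → ¬ T b → b ≡ false
¬T⁻ ¬Tb = ¬-not (¬Tb ∘ T⁺)

∧-true⁺ : ∀ {a b} → a ≡ true → b ≡ true → a ∧ b ≡ true
∧-true⁺ refl refl = refl

∧-true⁻ : ∀ {a b} → a ∧ b ≡ true → a ≡ true × b ≡ true
∧-true⁻ {true} b≡true = refl , b≡true

module _ {A : Set} where

  infix 4 _∈ᵇ_ _∉ᵇ_ _⊆ᵇ_
  infixr 7 _∩_
  infixl 6 _∖_

  _∈ᵇ_ _∉ᵇ_ : A → (A → Bool) → Set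
  x ∈ᵇ X = X x ≡ true
  x ∉ᵇ X = X x ≡ false

  _⊆ᵇ_ : (A → Bool) → (A → Bool) → Set
  X ⊆ᵇ Y = ∀ x → x ∈ᵇ X → x ∈ᵇ Y

  -- Opaque, so that the sets in a membership goal are recovered by unification.
  opaque
    _∩_ _∖_ : (A → Bool) → (A → Bool) → A → Bool
    (X ∩ Y) x = X x ∧ Y x
    (X ∖ Y) x = X x ∧ not (Y x)

    ∩⁺ : ∀ {x X Y} → x ∈ᵇ X → x ∈ᵇ Y → x ∈ᵇ X ∩ Y
    ∩⁺ = ∧-true⁺

    ∩⁻ˡ : ∀ {x X Y} → x ∈ᵇ X ∩ Y → x ∈ᵇ X
    ∩⁻ˡ = proj₁ ∘ ∧-true⁻

    ∩⁻ʳ : ∀ {x X Y} → x ∈ᵇ X ∩ Y → x ∈ᵇ Y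
    ∩⁻ʳ = proj₂ ∘ ∧-true⁻

    ∉∩⁻ : ∀ {x X Y} → x ∉ᵇ X ∩ Y → x ∈ᵇ X → x ∉ᵇ Y
    ∉∩⁻ x∉ x∈X rewrite x∈X = x∉

    ∉∩⁺ˡ : ∀ {x X Y} → x ∉ᵇ X → x ∉ᵇ X ∩ Y
    ∉∩⁺ˡ x∉X rewrite x∉X = refl

    ∖⁺ : ∀ {x X Y} → x ∈ᵇ X → x ∉ᵇ Y → x ∈ᵇ X ∖ Y
    ∖⁺ x∈X x∉Y = ∧-true⁺ x∈X (cong not x∉Y)

    ∖⁻ˡ : ∀ {x X Y} → x ∈ᵇ X ∖ Y → x ∈ᵇ X
    ∖⁻ˡ = proj₁ ∘ ∧-true⁻

    ∖⁻ʳ : ∀ {x X Y} → x ∈ᵇ X ∖ Y → x ∉ᵇ Y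
    ∖⁻ʳ = not-injective ∘ proj₂ ∘ ∧-true⁻

    ∉∖⁺ʳ : ∀ {x X Y} → x ∈ᵇ Y → x ∉ᵇ X ∖ Y
    ∉∖⁺ʳ {x} {X} x∈Y rewrite x∈Y = ∧-zeroʳ (X x)

    ∈⊎∈∖ : ∀ {x X} Y → x ∈ᵇ X → x ∈ᵇ Y ⊎ x ∈ᵇ X ∖ Y
    ∈⊎∈∖ {x} Y x∈X with Y x
    ... | true  = inj₁ refl
    ... | false = inj₂ (∧-true⁺ x∈X refl)

  ∖-⊆ : ∀ X Y → X ∖ Y ⊆ᵇ X
  ∖-⊆ X Y _ = ∖⁻ˡ

  opaque
    decSet : {P : A → Set} → Decidable P → A → Bool
    decSet P? x = does (P? x)

    ∈decSet⁺ : ∀ {P : A → Set} (P? : Decidable P) {x} → P x → x ∈ᵇ decSet P?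
    ∈decSet⁺ P? {x} = dec-true (P? x)

    ∈decSet⁻ : ∀ {P : A → Set} (P? : Decidable P) {x} → x ∈ᵇ decSet P? → P x
    ∈decSet⁻ P? {x} x∈ with P? x
    ... | yes Px = Px

    ∉decSet⁺ : ∀ {P : A → Set} (P? : Decidable P) {x} → ¬ P x → x ∉ᵇ decSet P?
    ∉decSet⁺ P? {x} = dec-false (P? x)

    ∉decSet⁻ : ∀ {P : A → Set} (P? : Decidable P) {x} → x ∉ᵇ decSet P? → ¬ P x
    ∉decSet⁻ P? {x} x∉ with P? x
    ... | no ¬Px = ¬Px

module _ {n : ℕ} where

  ｛_｝ : Fin n → Fin n → Bool
  ｛ v ｝ = decSet (_≟ᶠ v)

  ∈｛｝ : ∀ {v} → v ∈ᵇ ｛ v ｝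
  ∈｛｝ = ∈decSet⁺ (_≟ᶠ _) refl

  ∉｛｝ : ∀ {x v} → x ≢ v → x ∉ᵇ ｛ v ｝
  ∉｛｝ {v = v} = ∉decSet⁺ (_≟ᶠ v)

  ∈｛｝⁻ : ∀ {x v} → x ∈ᵇ ｛ v ｝ → x ≡ v
  ∈｛｝⁻ {v = v} = ∈decSet⁻ (_≟ᶠ v)

  ｛｝-⊆ : ∀ {v X} → v ∈ᵇ X → ｛ v ｝ ⊆ᵇ X
  ｛｝-⊆ {X = X} v∈X x x∈ = subst (_∈ᵇ X) (sym (∈｛｝⁻ x∈)) v∈X

  card : (Fin n → Bool) → ℕ
  card X = ∣ tabulate X ∣

  ∈-tabulate⁺ : ∀ (X : Fin n → Bool) {x} → x ∈ᵇ X → x ∈ tabulate X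
  ∈-tabulate⁺ X {x} x∈X = lookup⇒[]= x (tabulate X) (trans (lookup∘tabulate X x) x∈X)

  ∈-tabulate⁻ : ∀ (X : Fin n → Bool) {x} → x ∈ tabulate X → x ∈ᵇ X
  ∈-tabulate⁻ X {x} x∈ = trans (sym (lookup∘tabulate X x)) ([]=⇒lookup x∈)

  card-< : ∀ {X Y x} → X ⊆ᵇ Y → x ∈ᵇ Y → x ∉ᵇ X → card X < card Y
  card-< {X} {Y} {x} X⊆Y x∈Y x∉X = p⊂q⇒∣p∣<∣q∣ {n} {tabulate X} {tabulate Y}
    ( (λ x∈ → ∈-tabulate⁺ Y (X⊆Y _ (∈-tabulate⁻ X x∈)))
    , x , ∈-tabulate⁺ Y x∈Y , λ (x∈X : x ∈ tabulate X) → contradictionᵇ (∈-tabulate⁻ X x∈X) x∉X )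

module Decomposition (G : Graph) (G-cograph : IsCograph G) where

  noInducedP₄ : ∀ pol {v w x y} → v ≢ w → v ≢ x → v ≢ y → w ≢ x → w ≢ y → x ≢ y →
         adj G v w ≡ pol → adj G w x ≡ pol → adj G x y ≡ pol →
         adj G v x ≡ not pol → adj G v y ≡ not pol → adj G w y ≡ not pol → ⊥
  noInducedP₄ true v≢w v≢x v≢y w≢x w≢y x≢y vw wx xy vx vy wy =
    proj₂ G-cograph _ _ _ _ v≢w v≢x v≢y w≢x w≢y x≢y
      (T⁺ vw , T⁺ wx , T⁺ xy , ¬T⁺ vx , ¬T⁺ vy , ¬T⁺ wy)
  -- The complement of an induced P₄ on v, w, x, y is an induced P₄ on w, y, v, x.
  noInducedP₄ false {v} {w} {x} {y} v≢w v≢x v≢y w≢x w≢y x≢y vw wx xy vx vy wy =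
    noInducedP₄ true w≢y (v≢w ∘ sym) w≢x (v≢y ∘ sym) (x≢y ∘ sym) v≢x
      wy (trans (adj-sym G y v) vy) vx (trans (adj-sym G w v) vw) wx (trans (adj-sym G y x) xy)

  record Split (U : V G → Bool) (pol : Bool) : Set where
    field
      A B      : V G → Bool
      A⊆U      : A ⊆ᵇ U
      B⊆U      : B ⊆ᵇ U
      cover    : ∀ z → z ∈ᵇ U → z ∈ᵇ A ⊎ z ∈ᵇ B
      disjoint : ∀ z → z ∈ᵇ A → z ∈ᵇ B → ⊥
      a        : V G
      a∈A      : a ∈ᵇ A
      b        : V G
      b∈B      : b ∈ᵇ B
      across   : ∀ x y → x ∈ᵇ A → y ∈ᵇ B → adj G x y ≡ pol

    ∈B⇒∉A : ∀ {z} → z ∈ᵇ B → z ∉ᵇ A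
    ∈B⇒∉A z∈B = ¬-not (λ z∈A → disjoint _ z∈A z∈B)

    swap : Split U pol
    swap = record
      { A = B ; B = A ; A⊆U = B⊆U ; B⊆U = A⊆U
      ; cover = λ z z∈U → ⊎-swap (cover z z∈U)
      ; disjoint = λ z z∈B z∈A → disjoint z z∈A z∈B
      ; a = b ; a∈A = b∈B ; b = a ; b∈B = a∈A
      ; across = λ x y x∈B y∈A → trans (adj-sym G x y) (across y x y∈A x∈B) }

  orient : ∀ {U pol x} (s : Split U pol) → x ∈ᵇ U → Σ (Split U pol) λ t → x ∈ᵇ Split.A t
  orient s x∈U with Split.cover s _ x∈U
  ... | inj₁ x∈A = s , x∈A
  ... | inj₂ x∈B = Split.swap s , x∈B

  splitOff : ∀ {U pol} (A : V G → Bool) → A ⊆ᵇ U → ∀ {a b} → a ∈ᵇ A → b ∈ᵇ U → b ∉ᵇ A →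
             (∀ x y → x ∈ᵇ A → y ∈ᵇ U → y ∉ᵇ A → adj G x y ≡ pol) → Split U pol
  splitOff {U} A A⊆U a∈A b∈U b∉A across = record
    { A = A ; B = U ∖ A ; A⊆U = A⊆U ; B⊆U = ∖-⊆ U A
    ; cover = λ z z∈U → ∈⊎∈∖ A z∈U
    ; disjoint = λ z z∈A z∈U∖A → contradictionᵇ z∈A (∖⁻ʳ z∈U∖A)
    ; a∈A = a∈A ; b∈B = ∖⁺ b∈U b∉A
    ; across = λ x y x∈A y∈U∖A → across x y x∈A (∖⁻ˡ y∈U∖A) (∖⁻ʳ y∈U∖A) }

  -- Every cograph on at least two vertices is disconnected or has disconnected complement;
  -- this is the step putting the vertex v back into a split of U − v.
  module Extend {U : V G → Bool} {v : V G} (v∈U : v ∈ᵇ U) where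

    U-v : V G → Bool
    U-v = U ∖ ｛ v ｝

    ∈U-v⇒≢v : ∀ {z} → z ∈ᵇ U-v → v ≢ z
    ∈U-v⇒≢v z∈ refl = contradictionᵇ ∈｛｝ (∖⁻ʳ z∈)

    MixedPair : (V G → Bool) → Bool → Set
    MixedPair A pol = ∃₂ λ z x → z ∈ᵇ A × x ∈ᵇ A ×
      adj G v z ≡ pol × adj G v x ≡ not pol × adj G z x ≡ not pol

    -- v joins B, together with the vertices of A to which its adjacency is not pol.
    refine : ∀ {pol} (s : Split U-v pol) → ∀ {z} → z ∈ᵇ Split.A s → adj G v z ≡ pol →
             ¬ MixedPair (Split.A s) pol → Split U pol
    refine {pol} s z∈A vz noMixed =
      splitOff (A ∩ near) (λ x x∈ → ∖⁻ˡ (A⊆U x (∩⁻ˡ x∈)))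
        (∩⁺ z∈A (∈decSet⁺ near? vz)) v∈U (∉∩⁺ˡ v∉A) across′
      where
        open Split s
        near? = λ y → adj G v y ≟ᵇ pol
        near  = decSet near?
        v∉A : v ∉ᵇ A
        v∉A = ¬-not (λ v∈A → ∈U-v⇒≢v (A⊆U v v∈A) refl)
        across′ : ∀ x y → x ∈ᵇ A ∩ near → y ∈ᵇ U → y ∉ᵇ A ∩ near → adj G x y ≡ pol
        across′ x y x∈ y∈U y∉ with y ≟ᶠ v
        ... | yes refl = trans (adj-sym G x v) (∈decSet⁻ near? (∩⁻ʳ x∈))
        ... | no y≢v with cover y (∖⁺ y∈U (∉｛｝ y≢v))
        ...   | inj₂ y∈B = across x y (∩⁻ˡ x∈) y∈B
        ...   | inj₁ y∈A = ≢not⇒≡ λ xy → noMixed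
                  (x , y , ∩⁻ˡ x∈ , y∈A , ∈decSet⁻ near? (∩⁻ʳ x∈) ,
                   ¬-not (∉decSet⁻ near? (∉∩⁻ y∉ y∈A)) , xy)

    -- A mixed pair z, x with y would make v, z, y, x an induced P₄ of G or of its complement.
    noMixedPair : ∀ {pol} (s : Split U-v pol) → ∀ {y} → y ∈ᵇ Split.B s → adj G v y ≡ not pol →
                  ¬ MixedPair (Split.A s) pol
    noMixedPair {pol} s {y} y∈B vy (z , x , z∈A , x∈A , vz , vx , zx) =
      noInducedP₄ pol (∈U-v⇒≢v (A⊆U z z∈A)) (∈U-v⇒≢v (B⊆U y y∈B)) (∈U-v⇒≢v (A⊆U x x∈A))
        (λ { refl → disjoint z z∈A y∈B }) (λ { refl → not-¬ vz vx })
        (λ { refl → disjoint x x∈A y∈B })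
        vz (across z y z∈A y∈B) (trans (adj-sym G y x) (across x y x∈A y∈B)) vy vx zx
      where open Split s

    isolate : ∀ {pol u} → u ∈ᵇ U-v → (∀ z → z ∈ᵇ U-v → adj G v z ≡ not pol) → Split U (not pol)
    isolate u∈ far = splitOff ｛ v ｝ (｛｝-⊆ v∈U) ∈｛｝ (∖⁻ˡ u∈) (∉｛｝ (∈U-v⇒≢v u∈ ∘ sym))
      λ { x y x∈ y∈U y∉ → subst (λ x → adj G x y ≡ _) (sym (∈｛｝⁻ x∈)) (far y (∖⁺ y∈U y∉)) }

    module _ {pol} (s : Split U-v pol) where
      open Split s

      extend : Σ Bool (Split U)
      extend with any? (λ z → (A z ≟ᵇ true) ×-dec (adj G v z ≟ᵇ not pol))
      ... | no noA = pol , refine s a∈A (≢not⇒≡ λ va → noA (a , a∈A , va))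
                             λ (_ , x , _ , x∈A , _ , vx , _) → noA (x , x∈A , vx)
      ... | yes (a₀ , a₀∈A , va₀) with any? (λ z → (B z ≟ᵇ true) ×-dec (adj G v z ≟ᵇ not pol))
      ...   | no noB = pol , refine swap b∈B (≢not⇒≡ λ vb → noB (b , b∈B , vb))
                               λ (_ , x , _ , x∈B , _ , vx , _) → noB (x , x∈B , vx)
      ...   | yes (b₀ , b₀∈B , vb₀) with any? (λ z → (U-v z ≟ᵇ true) ×-dec (adj G v z ≟ᵇ pol))
      ...     | no noNear = not pol , isolate (A⊆U a₀ a₀∈A) λ z z∈ → ¬-not λ vz → noNear (z , z∈ , vz)
      ...     | yes (z , z∈ , vz) with cover z z∈
      ...       | inj₁ z∈A = pol , refine s z∈A vz (noMixedPair s b₀∈B vb₀)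
      ...       | inj₂ z∈B = pol , refine swap z∈B vz (noMixedPair swap a₀∈A va₀)

  split : ∀ U → Acc _<_ (card U) → ∀ {x y} → x ∈ᵇ U → y ∈ᵇ U → x ≢ y → Σ Bool (Split U)
  split U (acc smaller) {x} {y} x∈U y∈U x≢y
    with any? (λ p → any? (λ q → (U-x p ≟ᵇ true) ×-dec (U-x q ≟ᵇ true) ×-dec ¬? (p ≟ᶠ q)))
    where U-x = U ∖ ｛ x ｝
  ... | yes (p , q , p∈ , q∈ , p≢q) =
    Extend.extend x∈U (proj₂ (split (U ∖ ｛ x ｝) (smaller (card-< (∖-⊆ U ｛ x ｝) x∈U x∉U-x)) p∈ q∈ p≢q))
    where x∉U-x = ∉∖⁺ʳ ∈｛｝
  ... | no noPair = adj G x y , splitOff ｛ x ｝ (｛｝-⊆ x∈U) ∈｛｝ y∈U (∉｛｝ (x≢y ∘ sym)) across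
    where
      across : ∀ z w → z ∈ᵇ ｛ x ｝ → w ∈ᵇ U → w ∉ᵇ ｛ x ｝ → adj G z w ≡ adj G x y
      across z w z∈ w∈U w∉ with ∈｛｝⁻ z∈ | w ≟ᶠ y
      ... | refl | yes refl = refl
      ... | refl | no w≢y = ⊥-elim (noPair (w , y , ∖⁺ w∈U w∉ , ∖⁺ y∈U (∉｛｝ (x≢y ∘ sym)) , w≢y))

  record JoinComponent (U : V G → Bool) : Set where
    field
      K₁ K₂      : V G → Bool
      K₁⊆U       : K₁ ⊆ᵇ U
      K₂⊆U       : K₂ ⊆ᵇ U
      K-disjoint : ∀ z → z ∈ᵇ K₁ → z ∈ᵇ K₂ → ⊥
      k₁         : V G
      k₁∈K₁      : k₁ ∈ᵇ K₁
      k₂         : V G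
      k₂∈K₂      : k₂ ∈ᵇ K₂
      K-join     : ∀ x y → x ∈ᵇ K₁ → y ∈ᵇ K₂ → adj G x y ≡ true
      K-closed   : ∀ x u → x ∈ᵇ K₁ ⊎ x ∈ᵇ K₂ → u ∈ᵇ U → adj G x u ≡ true → u ∈ᵇ K₁ ⊎ u ∈ᵇ K₂

  adjacent-in-A : ∀ {U x y} (s : Split U false) → x ∈ᵇ Split.A s → y ∈ᵇ U → adj G x y ≡ true →
                  y ∈ᵇ Split.A s
  adjacent-in-A {y = y} s x∈A y∈U xy with Split.cover s y y∈U
  ... | inj₁ y∈A = y∈A
  ... | inj₂ y∈B = ⊥-elim (contradictionᵇ xy (Split.across s _ y x∈A y∈B))

  liftComponent : ∀ {U} (s : Split U false) → JoinComponent (Split.A s) → JoinComponent U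
  liftComponent {U} s K = record
    { K₁ = K₁ ; K₂ = K₂
    ; K₁⊆U = λ z z∈ → A⊆U z (K₁⊆U z z∈) ; K₂⊆U = λ z z∈ → A⊆U z (K₂⊆U z z∈)
    ; K-disjoint = K-disjoint ; k₁∈K₁ = k₁∈K₁ ; k₂∈K₂ = k₂∈K₂ ; K-join = K-join
    ; K-closed = closed }
    where
      open Split s
      open JoinComponent K
      K⊆A : ∀ {x} → x ∈ᵇ K₁ ⊎ x ∈ᵇ K₂ → x ∈ᵇ A
      K⊆A (inj₁ x∈K₁) = K₁⊆U _ x∈K₁
      K⊆A (inj₂ x∈K₂) = K₂⊆U _ x∈K₂
      closed : ∀ x u → x ∈ᵇ K₁ ⊎ x ∈ᵇ K₂ → u ∈ᵇ U → adj G x u ≡ true → u ∈ᵇ K₁ ⊎ u ∈ᵇ K₂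
      closed x u x∈K u∈U xu = K-closed x u x∈K (adjacent-in-A s (K⊆A x∈K) u∈U xu) xu

  swapComponent : ∀ {U} → JoinComponent U → JoinComponent U
  swapComponent K = record
    { K₁ = K₂ ; K₂ = K₁ ; K₁⊆U = K₂⊆U ; K₂⊆U = K₁⊆U
    ; K-disjoint = λ z z∈K₂ z∈K₁ → K-disjoint z z∈K₁ z∈K₂
    ; k₁∈K₁ = k₂∈K₂ ; k₂∈K₂ = k₁∈K₁
    ; K-join = λ x y x∈K₂ y∈K₁ → trans (adj-sym G x y) (K-join y x y∈K₁ x∈K₂)
    ; K-closed = λ x u x∈K u∈U xu → ⊎-swap (K-closed x u (⊎-swap x∈K) u∈U xu) }
    where open JoinComponent K

  joinComponent : ∀ U → Acc _<_ (card U) → ∀ {x y} → x ∈ᵇ U → y ∈ᵇ U → adj G x y ≡ true → JoinComponent U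
  joinComponent U (acc smaller) {x} {y} x∈U y∈U xy with split U (acc smaller) x∈U y∈U x≢y
    where
      x≢y : x ≢ y
      x≢y refl = contradictionᵇ xy (adj-irrefl G x)
  ... | true , s = record
    { K₁ = A ; K₂ = B ; K₁⊆U = A⊆U ; K₂⊆U = B⊆U ; K-disjoint = disjoint
    ; k₁∈K₁ = a∈A ; k₂∈K₂ = b∈B ; K-join = across ; K-closed = λ _ u _ u∈U _ → cover u u∈U }
    where open Split s
  ... | false , s with orient s x∈U
  ...   | t , x∈A = liftComponent t (joinComponent A (smaller (card-< A⊆U (B⊆U b b∈B) (∈B⇒∉A b∈B)))
                      x∈A (adjacent-in-A t x∈A y∈U xy) xy)
    where open Split t

any?-↔ : ∀ {X : Set} {n} → X ↔ Fin n → {Q : X → Set} → Decidable Q → Dec (∃ Q)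
any?-↔ X↔Fin {Q} Q? = map′ (λ (i , Qi) → from i , Qi) (λ (x , Qx) → to x , subst Q (sym (strictlyInverseʳ x)) Qx)
                             (any? (Q? ∘ from))
  where open Inverse X↔Fin

Dual-sym : ∀ {α β} → Dual α β → Dual β α
Dual-sym (pos-neg p) = neg-pos p
Dual-sym (neg-pos p) = pos-neg p

Fin2-pigeonhole : ∀ (x y z : Fin 2) → x ≡ y ⊎ x ≡ z ⊎ y ≡ z
Fin2-pigeonhole zero       zero       _          = inj₁ refl
Fin2-pigeonhole (suc zero) (suc zero) _          = inj₁ refl
Fin2-pigeonhole zero       (suc zero) zero       = inj₂ (inj₁ refl)
Fin2-pigeonhole zero       (suc zero) (suc zero) = inj₂ (inj₂ refl)
Fin2-pigeonhole (suc zero) zero       zero       = inj₂ (inj₂ refl)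
Fin2-pigeonhole (suc zero) zero       (suc zero) = inj₂ (inj₁ refl)

-- Colour classes are the fibres of a colouring; gluing tags the two sides apart.
data Colour : Set where
  leaf       : Colour
  left right : Colour → Colour

left-injective : ∀ {c d} → left c ≡ left d → c ≡ d
left-injective refl = refl

right-injective : ∀ {c d} → right c ≡ right d → c ≡ d
right-injective refl = refl

module ColouredGraphs {X : Set} (edge : X → X → Bool) (colour : X → Colour) where

  PairClassUnion : (X → Bool) → Set
  PairClassUnion W = (∀ x y → x ∈ᵇ W → colour x ≡ colour y → y ∈ᵇ W) ×
                     (∀ x → x ∈ᵇ W → ∃ λ y → y ≢ x × colour x ≡ colour y)

  UniqueNeighbour : (X → Bool) → X → Set
  UniqueNeighbour W x = ∃ λ y → y ∈ᵇ W × edge x y ≡ true × (∀ z → z ∈ᵇ W → edge x z ≡ true → z ≡ y)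

  Matching : (X → Bool) → Set
  Matching W = (∃ λ w → w ∈ᵇ W) × (∀ x → x ∈ᵇ W → UniqueNeighbour W x)

  Nice : Set
  Nice = ∀ W → PairClassUnion W → ¬ Matching W

  -- The strengthening of Nice that, unlike Nice itself, survives gluing.
  Nice⁺ : Set
  Nice⁺ = ∀ W c → PairClassUnion W → c ∈ᵇ W → (∀ y → y ∈ᵇ W → edge c y ≡ false) →
          ¬ (∀ x → x ∈ᵇ W → x ≢ c → UniqueNeighbour W x)

  NoP₄ : Set
  NoP₄ = ∀ {v w x y} → v ≢ w → v ≢ x → v ≢ y → w ≢ x → w ≢ y → x ≢ y →
         edge v w ≡ true → edge w x ≡ true → edge x y ≡ true →
         edge v x ≡ false → edge v y ≡ false → edge w y ≡ false → ⊥

  unique-neighbour-≡ : ∀ {W} x → UniqueNeighbour W x → ∀ {y z} → y ∈ᵇ W → edge x y ≡ true →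
                       z ∈ᵇ W → edge x z ≡ true → y ≡ z
  unique-neighbour-≡ _ (_ , _ , _ , unique) y∈W xy z∈W xz = trans (unique _ y∈W xy) (sym (unique _ z∈W xz))

module Edgeless {X : Set} (colour : X → Colour) where
  open ColouredGraphs (λ _ _ → false) colour

  edgeless-nice : Nice
  edgeless-nice W _ ((w , w∈W) , matched) with () ← proj₁ (proj₂ (proj₂ (matched w w∈W)))

  edgeless-nice⁺ : Nice⁺
  edgeless-nice⁺ W c (closed , paired) c∈W _ matched with paired c c∈W
  ... | y , y≢c , cy with () ← proj₁ (proj₂ (proj₂ (matched y (closed c y c∈W cy) y≢c)))

  edgeless-noP₄ : NoP₄
  edgeless-noP₄ _ _ _ _ _ _ ()

module Fragments (P : CombProp) where

  G : Graph
  G = graph P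

  ℓ : V G → Atom
  ℓ = label P

  open Decomposition G (cograph P) public

  record Fragment (U : V G → Bool) : Set₁ where
    field
      Vertex        : Set
      order         : ℕ
      enum          : Vertex ↔ Fin order
      edge          : Vertex → Vertex → Bool
      edge-sym      : ∀ x y → edge x y ≡ edge y x
      edge-irrefl   : ∀ x → edge x x ≡ false
      colour        : Vertex → Colour
      vertex₀       : Vertex
      noP₄          : ColouredGraphs.NoP₄ edge colour
      colour-stable : ∀ x y → colour x ≡ colour y → x ≢ y → edge x y ≡ false
      colour-≤2     : ∀ x y z → colour x ≡ colour y → colour x ≡ colour z → x ≡ y ⊎ x ≡ z ⊎ y ≡ z
      nice          : ColouredGraphs.Nice edge colour
      nice⁺         : ColouredGraphs.Nice⁺ edge colour
      h             : Vertex → V G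
      h∈U           : ∀ x → h x ∈ᵇ U
      h-hom         : ∀ x y → edge x y ≡ true → adj G (h x) (h y) ≡ true
      h-skew        : ∀ x w → w ∈ᵇ U → adj G (h x) w ≡ true → ∃ λ y → edge x y ≡ true × adj G (h y) w ≡ false
      axiomatic     : ∀ x → ((∀ y → colour x ≡ colour y → y ≡ x) × ℓ (h x) ≡ 𝟙) ⊎
                            (∃ λ y → y ≢ x × colour x ≡ colour y × Dual (ℓ (h x)) (ℓ (h y)))

    any?ⱽ : {Q : Vertex → Set} → Decidable Q → Dec (∃ Q)
    any?ⱽ = any?-↔ enum

  Stable : (V G → Bool) → Set
  Stable U = ∀ x y → x ∈ᵇ U → y ∈ᵇ U → adj G x y ≡ false

  axiom𝟙 : ∀ {U v} → Stable U → v ∈ᵇ U → ℓ v ≡ 𝟙 → Fragment U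
  axiom𝟙 {U} {v} U-stable v∈U v𝟙 = record
    { Vertex = Fin 1 ; enum = ↔-refl ; edge = λ _ _ → false
    ; edge-sym = λ _ _ → refl ; edge-irrefl = λ _ → refl ; colour = λ _ → leaf ; vertex₀ = zero
    ; noP₄ = edgeless-noP₄ ; colour-stable = λ _ _ _ _ → refl
    ; colour-≤2 = λ { zero zero _ _ _ → inj₁ refl }
    ; nice = edgeless-nice ; nice⁺ = edgeless-nice⁺
    ; h = λ _ → v ; h∈U = λ _ → v∈U ; h-hom = λ _ _ ()
    ; h-skew = λ _ w w∈U vw → ⊥-elim (contradictionᵇ vw (U-stable v w v∈U w∈U))
    ; axiomatic = λ { zero → inj₁ ((λ { zero _ → refl }) , v𝟙) } }
    where open Edgeless {Fin 1} (λ _ → leaf)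

  axiomDual : ∀ {U v w} → Stable U → v ∈ᵇ U → w ∈ᵇ U → Dual (ℓ v) (ℓ w) → Fragment U
  axiomDual {U} {v} {w} U-stable v∈U w∈U vw-dual = record
    { Vertex = Fin 2 ; enum = ↔-refl ; edge = λ _ _ → false
    ; edge-sym = λ _ _ → refl ; edge-irrefl = λ _ → refl ; colour = λ _ → leaf ; vertex₀ = zero
    ; noP₄ = edgeless-noP₄ ; colour-stable = λ _ _ _ _ → refl
    ; colour-≤2 = λ x y z _ _ → Fin2-pigeonhole x y z
    ; nice = edgeless-nice ; nice⁺ = edgeless-nice⁺
    ; h = h ; h∈U = h∈U ; h-hom = λ _ _ ()
    ; h-skew = λ x u u∈U xu → ⊥-elim (contradictionᵇ xu (U-stable (h x) u (h∈U x) u∈U))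
    ; axiomatic = λ { zero → inj₂ (suc zero , (λ ()) , refl , vw-dual)
                    ; (suc zero) → inj₂ (zero , (λ ()) , refl , Dual-sym vw-dual) } }
    where
      open Edgeless {Fin 2} (λ _ → leaf)
      h : Fin 2 → V G
      h zero       = v
      h (suc zero) = w
      h∈U : ∀ x → h x ∈ᵇ U
      h∈U zero       = v∈U
      h∈U (suc zero) = w∈U

  widen : ∀ {U′ U} (p : Fragment U′) → U′ ⊆ᵇ U →
          (∀ x w → w ∈ᵇ U → adj G (Fragment.h p x) w ≡ true → w ∈ᵇ U′) → Fragment U
  widen p U′⊆U closed = record
    { Fragment p
    ; h∈U = λ x → U′⊆U _ (h∈U x)
    ; h-skew = λ x w w∈U hxw → h-skew x w (closed x w w∈U hxw) hxw }
    where open Fragment p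

  module Side {U} (K : JoinComponent U) (p : Fragment (U ∖ JoinComponent.K₂ K)) where
    open JoinComponent K
    open Fragment p

    adjacent-to-K₂⇒∈K₁ : ∀ x w → w ∈ᵇ K₂ → adj G (h x) w ≡ true → h x ∈ᵇ K₁
    adjacent-to-K₂⇒∈K₁ x w w∈K₂ hxw
      with K-closed w (h x) (inj₂ w∈K₂) (∖⁻ˡ (h∈U x)) (trans (adj-sym G w (h x)) hxw)
    ... | inj₁ hx∈K₁ = hx∈K₁
    ... | inj₂ hx∈K₂ = ⊥-elim (contradictionᵇ hx∈K₂ (∖⁻ʳ (h∈U x)))

    edge-from-K₁ : ∀ x y → edge x y ≡ true → h x ∈ᵇ K₁ → h y ∈ᵇ K₁
    edge-from-K₁ x y xy hx∈K₁ with K-closed (h x) (h y) (inj₁ hx∈K₁) (∖⁻ˡ (h∈U y)) (h-hom x y xy)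
    ... | inj₁ hy∈K₁ = hy∈K₁
    ... | inj₂ hy∈K₂ = ⊥-elim (contradictionᵇ hy∈K₂ (∖⁻ʳ (h∈U y)))

    K₁-invariant : ∀ x y → edge x y ≡ true → K₁ (h x) ≡ K₁ (h y)
    K₁-invariant x y xy with K₁ (h x) in hx | K₁ (h y) in hy
    ... | true  | true  = refl
    ... | false | false = refl
    ... | true  | false = ⊥-elim (contradictionᵇ (edge-from-K₁ x y xy hx) hy)
    ... | false | true  = ⊥-elim (contradictionᵇ (edge-from-K₁ y x (trans (edge-sym y x) xy) hy) hx)

    closed-if-off-K₁ : (∀ x → h x ∈ᵇ K₁ → ⊥) → ∀ x w → w ∈ᵇ U → adj G (h x) w ≡ true → w ∈ᵇ U ∖ K₂
    closed-if-off-K₁ off x w w∈U hxw with K₂ w in w-K₂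
    ... | true  = ⊥-elim (off x (adjacent-to-K₂⇒∈K₁ x w w-K₂ hxw))
    ... | false = ∖⁺ w∈U w-K₂

  module _ {U} (K : JoinComponent U)
           (p : Fragment (U ∖ JoinComponent.K₂ K)) (q : Fragment (U ∖ JoinComponent.K₁ K)) where
    open JoinComponent K
    private
      module p = Fragment p
      module q = Fragment q

    side-skew : ∀ {y₀} → q.h y₀ ∈ᵇ K₂ → ∀ x w → w ∈ᵇ U → adj G (p.h x) w ≡ true →
                (∃ λ y → p.edge x y ≡ true × adj G (p.h y) w ≡ false) ⊎
                (p.h x ∈ᵇ K₁ × ∃ λ y → q.h y ∈ᵇ K₂ × adj G (q.h y) w ≡ false)
    side-skew {y₀} y₀∈K₂ x w w∈U xw with K₂ w in w-K₂
    ... | false = inj₁ (p.h-skew x w (∖⁺ w∈U w-K₂) xw)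
    ... | true with adj G (q.h y₀) w in y₀w
    ...   | false = inj₂ (Side.adjacent-to-K₂⇒∈K₁ K p x w w-K₂ xw , y₀ , y₀∈K₂ , y₀w)
    ...   | true with q.h-skew y₀ w (∖⁺ w∈U (¬-not (λ w∈K₁ → K-disjoint w w∈K₁ w-K₂))) y₀w
    ...     | y , y₀y , yw = inj₂ (Side.adjacent-to-K₂⇒∈K₁ K p x w w-K₂ xw , y ,
                               Side.edge-from-K₁ (swapComponent K) q y₀ y y₀y y₀∈K₂ , yw)

  module Glue {U} (K : JoinComponent U)
               (p₁ : Fragment (U ∖ JoinComponent.K₂ K)) (p₂ : Fragment (U ∖ JoinComponent.K₁ K))
               {x₀} (x₀∈K₁ : Fragment.h p₁ x₀ ∈ᵇ JoinComponent.K₁ K)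
               {y₀} (y₀∈K₂ : Fragment.h p₂ y₀ ∈ᵇ JoinComponent.K₂ K) where
    open JoinComponent K
    module P₁ = Fragment p₁
    module P₂ = Fragment p₂
    module C₁ = ColouredGraphs P₁.edge P₁.colour
    module C₂ = ColouredGraphs P₂.edge P₂.colour

    Vertex : Set
    Vertex = P₁.Vertex ⊎ P₂.Vertex

    opaque
      cross : P₁.Vertex → P₂.Vertex → Bool
      cross x y = K₁ (P₁.h x) ∧ K₂ (P₂.h y)

      cross⁺ : ∀ {x y} → P₁.h x ∈ᵇ K₁ → P₂.h y ∈ᵇ K₂ → cross x y ≡ true
      cross⁺ = ∧-true⁺

      cross⁻ˡ : ∀ {x y} → cross x y ≡ true → P₁.h x ∈ᵇ K₁
      cross⁻ˡ = proj₁ ∘ ∧-true⁻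

      cross⁻ʳ : ∀ {x y} → cross x y ≡ true → P₂.h y ∈ᵇ K₂
      cross⁻ʳ = proj₂ ∘ ∧-true⁻

    edge : Vertex → Vertex → Bool
    edge (inj₁ x) (inj₁ x′) = P₁.edge x x′
    edge (inj₂ y) (inj₂ y′) = P₂.edge y y′
    edge (inj₁ x) (inj₂ y)  = cross x y
    edge (inj₂ y) (inj₁ x)  = cross x y

    colour : Vertex → Colour
    colour (inj₁ x) = left (P₁.colour x)
    colour (inj₂ y) = right (P₂.colour y)

    h : Vertex → V G
    h (inj₁ x) = P₁.h x
    h (inj₂ y) = P₂.h y

    open ColouredGraphs edge colour

    edge-sym : ∀ u v → edge u v ≡ edge v u
    edge-sym (inj₁ x) (inj₁ x′) = P₁.edge-sym x x′
    edge-sym (inj₂ y) (inj₂ y′) = P₂.edge-sym y y′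
    edge-sym (inj₁ x) (inj₂ y)  = refl
    edge-sym (inj₂ y) (inj₁ x)  = refl

    edge-irrefl : ∀ u → edge u u ≡ false
    edge-irrefl (inj₁ x) = P₁.edge-irrefl x
    edge-irrefl (inj₂ y) = P₂.edge-irrefl y

    h-hom : ∀ u v → edge u v ≡ true → adj G (h u) (h v) ≡ true
    h-hom (inj₁ x) (inj₁ x′) xx′ = P₁.h-hom x x′ xx′
    h-hom (inj₂ y) (inj₂ y′) yy′ = P₂.h-hom y y′ yy′
    h-hom (inj₁ x) (inj₂ y)  xy  = K-join _ _ (cross⁻ˡ xy) (cross⁻ʳ xy)
    h-hom (inj₂ y) (inj₁ x)  xy  = trans (adj-sym G _ _) (K-join _ _ (cross⁻ˡ xy) (cross⁻ʳ xy))

    h∈U : ∀ u → h u ∈ᵇ U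
    h∈U (inj₁ x) = ∖⁻ˡ (P₁.h∈U x)
    h∈U (inj₂ y) = ∖⁻ˡ (P₂.h∈U y)

    h-skew : ∀ u w → w ∈ᵇ U → adj G (h u) w ≡ true → ∃ λ v → edge u v ≡ true × adj G (h v) w ≡ false
    h-skew (inj₁ x) w w∈U xw with side-skew K p₁ p₂ y₀∈K₂ x w w∈U xw
    ... | inj₁ (x′ , xx′ , x′w)       = inj₁ x′ , xx′ , x′w
    ... | inj₂ (x∈K₁ , y , y∈K₂ , yw) = inj₂ y , cross⁺ x∈K₁ y∈K₂ , yw
    h-skew (inj₂ y) w w∈U yw with side-skew (swapComponent K) p₂ p₁ x₀∈K₁ y w w∈U yw
    ... | inj₁ (y′ , yy′ , y′w)       = inj₂ y′ , yy′ , y′w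
    ... | inj₂ (y∈K₂ , x , x∈K₁ , xw) = inj₁ x , cross⁺ x∈K₁ y∈K₂ , xw

    colour-stable : ∀ u v → colour u ≡ colour v → u ≢ v → edge u v ≡ false
    colour-stable (inj₁ x) (inj₁ x′) c x≢x′ = P₁.colour-stable x x′ (left-injective c) (x≢x′ ∘ cong inj₁)
    colour-stable (inj₂ y) (inj₂ y′) c y≢y′ = P₂.colour-stable y y′ (right-injective c) (y≢y′ ∘ cong inj₂)

    colour-≤2 : ∀ u v w → colour u ≡ colour v → colour u ≡ colour w → u ≡ v ⊎ u ≡ w ⊎ v ≡ w
    colour-≤2 (inj₁ x) (inj₁ x′) (inj₁ x″) c c′ =
      ⊎-map (cong inj₁) (⊎-map (cong inj₁) (cong inj₁))
        (P₁.colour-≤2 x x′ x″ (left-injective c) (left-injective c′))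
    colour-≤2 (inj₂ y) (inj₂ y′) (inj₂ y″) c c′ =
      ⊎-map (cong inj₂) (⊎-map (cong inj₂) (cong inj₂))
        (P₂.colour-≤2 y y′ y″ (right-injective c) (right-injective c′))

    axiomatic : ∀ u → ((∀ v → colour u ≡ colour v → v ≡ u) × ℓ (h u) ≡ 𝟙) ⊎
                      (∃ λ v → v ≢ u × colour u ≡ colour v × Dual (ℓ (h u)) (ℓ (h v)))
    axiomatic (inj₁ x) with P₁.axiomatic x
    ... | inj₁ (alone , x𝟙) = inj₁ ((λ { (inj₁ x′) c → cong inj₁ (alone x′ (left-injective c)) }) , x𝟙)
    ... | inj₂ (x′ , x′≢x , c , dual) = inj₂ (inj₁ x′ , x′≢x ∘ inj₁-injective , cong left c , dual)
    axiomatic (inj₂ y) with P₂.axiomatic y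
    ... | inj₁ (alone , y𝟙) = inj₁ ((λ { (inj₂ y′) c → cong inj₂ (alone y′ (right-injective c)) }) , y𝟙)
    ... | inj₂ (y′ , y′≢y , c , dual) = inj₂ (inj₂ y′ , y′≢y ∘ inj₂-injective , cong right c , dual)

    enum : Vertex ↔ Fin (P₁.order + P₂.order)
    enum = ↔-trans (P₁.enum ⊎-↔ P₂.enum) (↔-sym +↔⊎)

    core : Vertex → Bool
    core (inj₁ x) = K₁ (P₁.h x)
    core (inj₂ y) = K₂ (P₂.h y)

    onLeft : Vertex → Bool
    onLeft (inj₁ _) = true
    onLeft (inj₂ _) = false

    core-invariant : ∀ u v → edge u v ≡ true → core u ≡ core v
    core-invariant (inj₁ x) (inj₁ x′) xx′ = Side.K₁-invariant K p₁ x x′ xx′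
    core-invariant (inj₂ y) (inj₂ y′) yy′ = Side.K₁-invariant (swapComponent K) p₂ y y′ yy′
    core-invariant (inj₁ x) (inj₂ y)  xy  = trans (cross⁻ˡ xy) (sym (cross⁻ʳ xy))
    core-invariant (inj₂ y) (inj₁ x)  xy  = trans (cross⁻ʳ xy) (sym (cross⁻ˡ xy))

    off-core-edge-one-sided : ∀ u v → edge u v ≡ true → core u ≡ false → onLeft u ≡ onLeft v
    off-core-edge-one-sided (inj₁ _) (inj₁ _) _  _     = refl
    off-core-edge-one-sided (inj₂ _) (inj₂ _) _  _     = refl
    off-core-edge-one-sided (inj₁ _) (inj₂ _) xy x-off = ⊥-elim (contradictionᵇ (cross⁻ˡ xy) x-off)
    off-core-edge-one-sided (inj₂ _) (inj₁ _) xy y-off = ⊥-elim (contradictionᵇ (cross⁻ʳ xy) y-off)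

    core-non-edge-one-sided : ∀ u v → core u ≡ true → core v ≡ true → edge u v ≡ false → onLeft u ≡ onLeft v
    core-non-edge-one-sided (inj₁ _) (inj₁ _) _    _    _  = refl
    core-non-edge-one-sided (inj₂ _) (inj₂ _) _    _    _  = refl
    core-non-edge-one-sided (inj₁ _) (inj₂ _) x∈K₁ y∈K₂ xy = ⊥-elim (contradictionᵇ (cross⁺ x∈K₁ y∈K₂) xy)
    core-non-edge-one-sided (inj₂ _) (inj₁ _) y∈K₂ x∈K₁ xy = ⊥-elim (contradictionᵇ (cross⁺ x∈K₁ y∈K₂) xy)

    one-sided-noP₄ : ∀ {v w x y} → onLeft v ≡ onLeft w → onLeft w ≡ onLeft x → onLeft x ≡ onLeft y →
                     v ≢ w → v ≢ x → v ≢ y → w ≢ x → w ≢ y → x ≢ y →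
                     edge v w ≡ true → edge w x ≡ true → edge x y ≡ true →
                     edge v x ≡ false → edge v y ≡ false → edge w y ≡ false → ⊥
    one-sided-noP₄ {inj₁ _} {inj₁ _} {inj₁ _} {inj₁ _} _ _ _ v≢w v≢x v≢y w≢x w≢y x≢y =
      P₁.noP₄ (v≢w ∘ cong inj₁) (v≢x ∘ cong inj₁) (v≢y ∘ cong inj₁)
              (w≢x ∘ cong inj₁) (w≢y ∘ cong inj₁) (x≢y ∘ cong inj₁)
    one-sided-noP₄ {inj₂ _} {inj₂ _} {inj₂ _} {inj₂ _} _ _ _ v≢w v≢x v≢y w≢x w≢y x≢y =
      P₂.noP₄ (v≢w ∘ cong inj₂) (v≢x ∘ cong inj₂) (v≢y ∘ cong inj₂)
              (w≢x ∘ cong inj₂) (w≢y ∘ cong inj₂) (x≢y ∘ cong inj₂)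
    one-sided-noP₄ {inj₁ _} {inj₂ _} () _ _
    one-sided-noP₄ {inj₂ _} {inj₁ _} () _ _
    one-sided-noP₄ {inj₁ _} {inj₁ _} {inj₂ _} _ () _
    one-sided-noP₄ {inj₂ _} {inj₂ _} {inj₁ _} _ () _
    one-sided-noP₄ {inj₁ _} {inj₁ _} {inj₁ _} {inj₂ _} _ _ ()
    one-sided-noP₄ {inj₂ _} {inj₂ _} {inj₂ _} {inj₁ _} _ _ ()

    -- Edges preserve being in the core, edges outside it stay on one side, and core vertices on
    -- different sides are adjacent; hence every induced P₄ lies on one side.
    glued-noP₄ : NoP₄
    glued-noP₄ {v} {w} {x} {y} v≢w v≢x v≢y w≢x w≢y x≢y vw wx xy vx vy wy with core v in v-core
    ... | false = one-sided-noP₄ (off-core-edge-one-sided v w vw v-core)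
                    (off-core-edge-one-sided w x wx w-core) (off-core-edge-one-sided x y xy x-core)
                    v≢w v≢x v≢y w≢x w≢y x≢y vw wx xy vx vy wy
      where
        w-core = trans (sym (core-invariant v w vw)) v-core
        x-core = trans (sym (core-invariant w x wx)) w-core
    ... | true = one-sided-noP₄ (trans v~y (sym w~y)) (trans w~y (trans (sym v~y) v~x)) (trans (sym v~x) v~y)
                   v≢w v≢x v≢y w≢x w≢y x≢y vw wx xy vx vy wy
      where
        w-core = trans (sym (core-invariant v w vw)) v-core
        x-core = trans (sym (core-invariant w x wx)) w-core
        y-core = trans (sym (core-invariant x y xy)) x-core
        v~x = core-non-edge-one-sided v x v-core x-core vx
        v~y = core-non-edge-one-sided v y v-core y-core vy
        w~y = core-non-edge-one-sided w y w-core y-core wy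

    pairs₁ : ∀ {W} → PairClassUnion W → C₁.PairClassUnion (W ∘ inj₁)
    pairs₁ {W} (closed , paired) = (λ x x′ x∈ c → closed (inj₁ x) (inj₁ x′) x∈ (cong left c)) , partner
      where
        partner : ∀ x → x ∈ᵇ W ∘ inj₁ → ∃ λ x′ → x′ ≢ x × P₁.colour x ≡ P₁.colour x′
        partner x x∈ with paired (inj₁ x) x∈
        ... | inj₁ x′ , x′≢x , c = x′ , x′≢x ∘ cong inj₁ , left-injective c

    pairs₂ : ∀ {W} → PairClassUnion W → C₂.PairClassUnion (W ∘ inj₂)
    pairs₂ {W} (closed , paired) = (λ y y′ y∈ c → closed (inj₂ y) (inj₂ y′) y∈ (cong right c)) , partner
      where
        partner : ∀ y → y ∈ᵇ W ∘ inj₂ → ∃ λ y′ → y′ ≢ y × P₂.colour y ≡ P₂.colour y′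
        partner y y∈ with paired (inj₂ y) y∈
        ... | inj₂ y′ , y′≢y , c = y′ , y′≢y ∘ cong inj₂ , right-injective c

    restrict₁ : ∀ {W x} → UniqueNeighbour W (inj₁ x) → (∀ y → inj₂ y ∈ᵇ W → cross x y ≡ true → ⊥) →
                C₁.UniqueNeighbour (W ∘ inj₁) x
    restrict₁ (inj₁ x′ , x′∈ , xx′ , unique) _ = x′ , x′∈ , xx′ , λ z z∈ xz → inj₁-injective (unique (inj₁ z) z∈ xz)
    restrict₁ (inj₂ y , y∈ , xy , _) no-cross = ⊥-elim (no-cross y y∈ xy)

    restrict₂ : ∀ {W y} → UniqueNeighbour W (inj₂ y) → (∀ x → inj₁ x ∈ᵇ W → cross x y ≡ true → ⊥) →
                C₂.UniqueNeighbour (W ∘ inj₂) y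
    restrict₂ (inj₂ y′ , y′∈ , yy′ , unique) _ = y′ , y′∈ , yy′ , λ z z∈ yz → inj₂-injective (unique (inj₂ z) z∈ yz)
    restrict₂ (inj₁ x , x∈ , xy , _) no-cross = ⊥-elim (no-cross x x∈ xy)

    CrossIn : (Vertex → Bool) → Set
    CrossIn W = ∃₂ λ x y → inj₁ x ∈ᵇ W × inj₂ y ∈ᵇ W × cross x y ≡ true

    crossIn? : ∀ W → Dec (CrossIn W)
    crossIn? W = P₁.any?ⱽ λ x → P₂.any?ⱽ λ y →
      (W (inj₁ x) ≟ᵇ true) ×-dec (W (inj₂ y) ≟ᵇ true) ×-dec (cross x y ≟ᵇ true)

    -- A cross edge x y of W is the only W-edge at x and at y, so on either side W is a matching
    -- plus one isolated vertex.
    module _ {W x y} (x∈ : inj₁ x ∈ᵇ W) (y∈ : inj₂ y ∈ᵇ W) (xy : cross x y ≡ true) where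

      blocked₁ : PairClassUnion W → UniqueNeighbour W (inj₁ x) → UniqueNeighbour W (inj₂ y) →
                 (∀ x′ → inj₁ x′ ∈ᵇ W → x′ ≢ x → UniqueNeighbour W (inj₁ x′)) → ⊥
      blocked₁ pairs x-matched y-matched others =
        P₁.nice⁺ (W ∘ inj₁) x (pairs₁ pairs) x∈ isolated
          (λ x′ x′∈ x′≢x → restrict₁ (others x′ x′∈ x′≢x) λ y′ y′∈ x′y′ → x′≢x (only x′∈ x′y′))
        where
          isolated : ∀ x′ → inj₁ x′ ∈ᵇ W → P₁.edge x x′ ≡ false
          isolated x′ x′∈ = ¬-not λ xx′ → case (unique-neighbour-≡ (inj₁ x) x-matched x′∈ xx′ y∈ xy)
            where case : inj₁ x′ ≢ inj₂ y
                  case ()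
          only : ∀ {x′ y′} → inj₁ x′ ∈ᵇ W → cross x′ y′ ≡ true → x′ ≡ x
          only x′∈ x′y′ = inj₁-injective
            (unique-neighbour-≡ (inj₂ y) y-matched x′∈ (cross⁺ (cross⁻ˡ x′y′) (cross⁻ʳ xy)) x∈ xy)

      blocked₂ : PairClassUnion W → UniqueNeighbour W (inj₁ x) → UniqueNeighbour W (inj₂ y) →
                 (∀ y′ → inj₂ y′ ∈ᵇ W → y′ ≢ y → UniqueNeighbour W (inj₂ y′)) → ⊥
      blocked₂ pairs x-matched y-matched others =
        P₂.nice⁺ (W ∘ inj₂) y (pairs₂ pairs) y∈ isolated
          (λ y′ y′∈ y′≢y → restrict₂ (others y′ y′∈ y′≢y) λ x′ x′∈ x′y′ → y′≢y (only y′∈ x′y′))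
        where
          isolated : ∀ y′ → inj₂ y′ ∈ᵇ W → P₂.edge y y′ ≡ false
          isolated y′ y′∈ = ¬-not λ yy′ → case (unique-neighbour-≡ (inj₂ y) y-matched y′∈ yy′ x∈ xy)
            where case : inj₂ y′ ≢ inj₁ x
                  case ()
          only : ∀ {x′ y′} → inj₂ y′ ∈ᵇ W → cross x′ y′ ≡ true → y′ ≡ y
          only y′∈ x′y′ = inj₂-injective
            (unique-neighbour-≡ (inj₁ x) x-matched y′∈ (cross⁺ (cross⁻ˡ xy) (cross⁻ʳ x′y′)) y∈ xy)

    glued-nice : Nice
    glued-nice W pairs ((w , w∈) , matched) with crossIn? W
    ... | yes (x , y , x∈ , y∈ , xy) =
      blocked₁ x∈ y∈ xy pairs (matched _ x∈) (matched _ y∈) (λ x′ x′∈ _ → matched _ x′∈)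
    ... | no no-cross = one-side w w∈
      where
        one-side : ∀ w → w ∈ᵇ W → ⊥
        one-side (inj₁ x) x∈ = P₁.nice (W ∘ inj₁) (pairs₁ pairs) ((x , x∈) , λ x′ x′∈ →
          restrict₁ (matched _ x′∈) λ y y∈ x′y → no-cross (x′ , y , x′∈ , y∈ , x′y))
        one-side (inj₂ y) y∈ = P₂.nice (W ∘ inj₂) (pairs₂ pairs) ((y , y∈) , λ y′ y′∈ →
          restrict₂ (matched _ y′∈) λ x x∈ xy′ → no-cross (x , y′ , x∈ , y′∈ , xy′))

    glued-nice⁺ : Nice⁺
    glued-nice⁺ W (inj₁ c) pairs c∈ c-isolated matched with crossIn? W
    ... | yes (x , y , x∈ , y∈ , xy) =
      blocked₂ x∈ y∈ xy pairs (matched _ x∈ x≢c) (matched _ y∈ λ ()) (λ y′ y′∈ _ → matched _ y′∈ λ ())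
      where
        x≢c : inj₁ x ≢ inj₁ c
        x≢c refl = contradictionᵇ xy (c-isolated (inj₂ y) y∈)
    ... | no no-cross = P₁.nice⁺ (W ∘ inj₁) c (pairs₁ pairs) c∈ (λ x x∈ → c-isolated (inj₁ x) x∈)
      λ x x∈ x≢c → restrict₁ (matched _ x∈ (x≢c ∘ inj₁-injective)) λ y y∈ xy → no-cross (x , y , x∈ , y∈ , xy)
    glued-nice⁺ W (inj₂ c) pairs c∈ c-isolated matched with crossIn? W
    ... | yes (x , y , x∈ , y∈ , xy) =
      blocked₁ x∈ y∈ xy pairs (matched _ x∈ λ ()) (matched _ y∈ y≢c) (λ x′ x′∈ _ → matched _ x′∈ λ ())
      where
        y≢c : inj₂ y ≢ inj₂ c
        y≢c refl = contradictionᵇ xy (c-isolated (inj₁ x) x∈)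
    ... | no no-cross = P₂.nice⁺ (W ∘ inj₂) c (pairs₂ pairs) c∈ (λ y y∈ → c-isolated (inj₂ y) y∈)
      λ y y∈ y≢c → restrict₂ (matched _ y∈ (y≢c ∘ inj₂-injective)) λ x x∈ xy → no-cross (x , y , x∈ , y∈ , xy)

    glue : Fragment U
    glue = record
      { Vertex = Vertex ; enum = enum ; edge = edge ; edge-sym = edge-sym ; edge-irrefl = edge-irrefl
      ; colour = colour ; vertex₀ = inj₁ x₀ ; noP₄ = glued-noP₄
      ; colour-stable = colour-stable ; colour-≤2 = colour-≤2 ; nice = glued-nice ; nice⁺ = glued-nice⁺
      ; h = h ; h∈U = h∈U ; h-hom = h-hom ; h-skew = h-skew ; axiomatic = axiomatic }

  everything : V G → Bool
  everything _ = true

  Dominates : (V G → Bool) → (V G → Bool) → Set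
  Dominates S X = ∀ x → x ∈ᵇ X → x ∉ᵇ S → ∃ λ s → s ∈ᵇ S × adj G x s ≡ true

  MaximalStableLifts : (V G → Bool) → Set
  MaximalStableLifts U = ∀ S → S ⊆ᵇ U → Stable S → Dominates S U → Dominates S everything

  module _ {U} (K : JoinComponent U) where
    open JoinComponent K

    combine : Fragment (U ∖ K₂) → Fragment (U ∖ K₁) → Fragment U
    combine p₁ p₂ with Fragment.any?ⱽ p₁ (λ x → K₁ (Fragment.h p₁ x) ≟ᵇ true)
    ... | no off₁ = widen p₁ (∖-⊆ U K₂) (Side.closed-if-off-K₁ K p₁ λ x x∈ → off₁ (x , x∈))
    ... | yes (x₀ , x₀∈K₁) with Fragment.any?ⱽ p₂ (λ y → K₂ (Fragment.h p₂ y) ≟ᵇ true)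
    ...   | no off₂ = widen p₂ (∖-⊆ U K₁) (Side.closed-if-off-K₁ (swapComponent K) p₂ λ y y∈ → off₂ (y , y∈))
    ...   | yes (y₀ , y₀∈K₂) = Glue.glue K p₁ p₂ x₀∈K₁ y₀∈K₂

    -- A vertex of K₂ is adjacent to all of K₁, and S contains k₁ or a neighbour of k₁, which lies in K₁.
    lifts-∖K₂ : MaximalStableLifts U → MaximalStableLifts (U ∖ K₂)
    lifts-∖K₂ lifts S S⊆ S-stable dominates = lifts S (λ s s∈ → ∖⁻ˡ (S⊆ s s∈)) S-stable dominates′
      where
        dominates′ : Dominates S U
        dominates′ x x∈U x∉S with K₂ x in x-K₂
        ... | false = dominates x (∖⁺ x∈U x-K₂) x∉S
        ... | true with S k₁ in k₁-S
        ...   | true = k₁ , k₁-S , trans (adj-sym G x k₁) (K-join k₁ x k₁∈K₁ x-K₂)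
        ...   | false with dominates k₁ (∖⁺ (K₁⊆U k₁ k₁∈K₁) (¬-not (K-disjoint k₁ k₁∈K₁))) k₁-S
        ...     | s , s∈S , k₁s with K-closed k₁ s (inj₁ k₁∈K₁) (∖⁻ˡ (S⊆ s s∈S)) k₁s
        ...       | inj₁ s∈K₁ = s , s∈S , trans (adj-sym G x s) (K-join s x s∈K₁ x-K₂)
        ...       | inj₂ s∈K₂ = ⊥-elim (contradictionᵇ s∈K₂ (∖⁻ʳ (S⊆ s s∈S)))

module Construction (P : CombProp) (P-true : IsTrue P) where
  open Fragments P

  stable-fragment : ∀ {U} → Stable U → MaximalStableLifts U → Fragment U
  stable-fragment {U} U-stable lifts with P-true (tabulate U) (U-stable′ , maximal)
    where
      U-stable′ : IsStable G (tabulate U)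
      U-stable′ v w v∈ w∈ = ¬T⁺ (U-stable v w (∈-tabulate⁻ U v∈) (∈-tabulate⁻ U w∈))
      dominates : Dominates U everything
      dominates = lifts U (λ _ x∈ → x∈) U-stable λ x x∈U x∉U → ⊥-elim (contradictionᵇ x∈U x∉U)
      maximal : ∀ T → IsStable G T → (∀ {x} → x ∈ tabulate U → x ∈ T) → ∀ {x} → x ∈ T → x ∈ tabulate U
      maximal T T-stable U⊆T {x} x∈T with U x in x-U
      ... | true  = ∈-tabulate⁺ U x-U
      ... | false with dominates x refl x-U
      ...   | s , s∈U , xs = ⊥-elim (T-stable x s x∈T (U⊆T (∈-tabulate⁺ U s∈U)) (T⁺ xs))
  ... | inj₁ (v , v∈ , v𝟙) = axiom𝟙 U-stable (∈-tabulate⁻ U v∈) v𝟙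
  ... | inj₂ (v , w , v∈ , w∈ , dual) = axiomDual U-stable (∈-tabulate⁻ U v∈) (∈-tabulate⁻ U w∈) dual

  build : ∀ U → Acc _<_ (card U) → MaximalStableLifts U → Fragment U
  build U (acc smaller) lifts
    with any? (λ x → any? (λ y → (U x ≟ᵇ true) ×-dec (U y ≟ᵇ true) ×-dec (adj G x y ≟ᵇ true)))
  ... | no no-edge = stable-fragment (λ x y x∈ y∈ → ¬-not λ xy → no-edge (x , y , x∈ , y∈ , xy)) lifts
  ... | yes (x , y , x∈ , y∈ , xy) = combine K
      (build (U ∖ K₂) (smaller (card-< (∖-⊆ U K₂) (K₂⊆U k₂ k₂∈K₂) (∉∖⁺ʳ k₂∈K₂))) (lifts-∖K₂ K lifts))
      (build (U ∖ K₁) (smaller (card-< (∖-⊆ U K₁) (K₁⊆U k₁ k₁∈K₁) (∉∖⁺ʳ k₁∈K₁))) (lifts-∖K₂ (swapComponent K) lifts))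
    where
      K = joinComponent U (acc smaller) x∈ y∈ xy
      open JoinComponent K

  fragment : Fragment everything
  fragment = build everything (<-wellFounded _) λ S _ _ dominates → dominates

module Enumerate {P : CombProp} (p : Fragments.Fragment P (Fragments.everything P)) where
  open Fragments P using (G; ℓ)
  open Fragments.Fragment p
  open Inverse enum using (to; from; strictlyInverseˡ; strictlyInverseʳ)
  open ColouredGraphs edge colour

  from-injective : ∀ {i j} → from i ≡ from j → i ≡ j
  from-injective {i} {j} eq = trans (sym (strictlyInverseˡ i)) (trans (cong to eq) (strictlyInverseˡ j))

  C-graph : Graph
  C-graph = record
    { size = order ; adj = λ i j → edge (from i) (from j)
    ; adj-sym = λ i j → edge-sym (from i) (from j) ; adj-irrefl = λ i → edge-irrefl (from i) }

  C : ColouredGraph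
  C = record
    { cgraph = C-graph ; _~_ = λ i j → colour (from i) ≡ colour (from j)
    ; ~-equiv = record { refl = refl ; sym = sym ; trans = trans }
    ; ~-stable = λ i j c i≢j → ¬T⁺ (colour-stable _ _ c (i≢j ∘ from-injective)) }

  C-cograph : IsCograph C-graph
  C-cograph = to vertex₀ , λ v w x y v≢w v≢x v≢y w≢x w≢y x≢y (vw , wx , xy , ¬vx , ¬vy , ¬wy) →
    noP₄ (v≢w ∘ from-injective) (v≢x ∘ from-injective) (v≢y ∘ from-injective)
         (w≢x ∘ from-injective) (w≢y ∘ from-injective) (x≢y ∘ from-injective)
         (T⁻ vw) (T⁻ wx) (T⁻ xy) (¬T⁻ ¬vx) (¬T⁻ ¬vy) (¬T⁻ ¬wy)

  pullback : Subset order → Vertex → Bool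
  pullback W x = lookup W (to x)

  ∈pullback⁻ : ∀ {W x} → x ∈ᵇ pullback W → to x ∈ W
  ∈pullback⁻ {W} {x} = lookup⇒[]= (to x) W

  ∈pullback⁺ : ∀ {W i} → i ∈ W → from i ∈ᵇ pullback W
  ∈pullback⁺ {W} {i} i∈W = trans (cong (lookup W) (strictlyInverseˡ i)) ([]=⇒lookup i∈W)

  pullback-pairs : ∀ W → IsUnionOfPairClasses C W → PairClassUnion (pullback W)
  pullback-pairs W (closed , paired) = closed′ , paired′
    where
      closed′ : ∀ x y → x ∈ᵇ pullback W → colour x ≡ colour y → y ∈ᵇ pullback W
      closed′ x y x∈ c = subst (_∈ᵇ pullback W) (strictlyInverseʳ y) (∈pullback⁺ (closed (to x) (to y) (∈pullback⁻ x∈)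
        (trans (cong colour (strictlyInverseʳ x)) (trans c (sym (cong colour (strictlyInverseʳ y)))))))
      paired′ : ∀ x → x ∈ᵇ pullback W → ∃ λ y → y ≢ x × colour x ≡ colour y
      paired′ x x∈ with paired (to x) (∈pullback⁻ x∈)
      ... | j , j≢x , c = from j , (λ { refl → j≢x (sym (strictlyInverseˡ j)) }) ,
                          trans (sym (cong colour (strictlyInverseʳ x))) c

  pullback-matching : ∀ W → InducesMatching C-graph W → Matching (pullback W)
  pullback-matching W ((i , i∈W) , matched) = (from i , ∈pullback⁺ i∈W) , unique
    where
      unique : ∀ x → x ∈ᵇ pullback W → UniqueNeighbour (pullback W) x
      unique x x∈ with matched (to x) (∈pullback⁻ x∈)
      ... | j , j∈W , xj , only =
        from j , ∈pullback⁺ j∈W , subst (λ z → edge z (from j) ≡ true) (strictlyInverseʳ x) (T⁻ xj) ,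
        λ z z∈ xz → trans (sym (strictlyInverseʳ z)) (cong from (only (to z) (∈pullback⁻ z∈)
          (T⁺ (trans (cong₂ edge (strictlyInverseʳ x) (strictlyInverseʳ z)) xz))))

  C-nice : IsNicelyColoured C
  C-nice = (λ i j k c c′ → ⊎-map from-injective (⊎-map from-injective from-injective)
                             (colour-≤2 (from i) (from j) (from k) c c′))
         , λ W pairs matching → nice (pullback W) (pullback-pairs W pairs) (pullback-matching W matching)

  h-skew′ : IsSkewFibration C-graph G (h ∘ from)
  h-skew′ = (λ i j ij → T⁺ (h-hom _ _ (T⁻ ij))) , skew
    where
      skew : ∀ i w → Edge G (h (from i)) w → ∃ λ j → Edge C-graph i j × ¬ Edge G (h (from j)) w
      skew i w iw with h-skew (from i) w refl (T⁻ iw)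
      ... | y , iy , yw = to y , T⁺ (trans (cong (edge (from i)) (strictlyInverseʳ y)) iy) ,
                          ¬T⁺ (trans (cong (λ z → adj G (h z) w) (strictlyInverseʳ y)) yw)

  C-axiomatic : AxiomaticClasses C (λ i → ℓ (h (from i)))
  C-axiomatic i with axiomatic (from i)
  ... | inj₁ (alone , i𝟙) = inj₁ ((λ j c → from-injective (alone (from j) c)) , i𝟙)
  ... | inj₂ (y , y≢i , c , dual) =
    inj₂ (to y , (λ { refl → y≢i (sym (strictlyInverseʳ y)) }) , trans c (cong colour (sym (strictlyInverseʳ y))) ,
          subst (λ z → Dual (ℓ (h (from i))) (ℓ (h z))) (sym (strictlyInverseʳ y)) dual)

  combProof : CombProof P
  combProof = record
    { C = C ; C-cograph = C-cograph ; C-nice = C-nice ; h = h ∘ from ; h-skew = h-skew′ ; axiomatic = C-axiomatic }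

theorem4 : (P : CombProp) → IsTrue P → CombProof P
theorem4 P P-true = Enumerate.combProof (Construction.fragment P P-true)
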